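{- $A$ has no submatrices of the following forms, where $x$, $y$, and $z$ are distinct non-zero entries: \[(i)\ \begin{bmatrix} x&y&x\\ y&y&0\\ x&0&0 \end{bmatrix};\ (ii)\ \begin{bmatrix} x&y&x\\ y&y&0\\ x&0&z \end{bmatrix}.\]
   Context: Let $M$ be a $\mathrm{GF}(4)$-representable matroid on $E$ with a circuit-hyperplane $X$; choose $e\in X$, $f\in E-X$ with $(X-e)\cup f$ a basis of $M$, and write $M=M[I\mid C]$ with $C=\begin{bmatrix} A & \underline{1}\\ \underline{1}^{T} & 0\end{bmatrix}$ (rows $(X-e)\cup f$, columns $((E-X)-f)\cup e$, row $f$ and column $e$ last, all non-zero entries of row $f$ and column $e$ scaled to $1$). Let $M'$ be obtained from $M$ by relaxing $X$, and suppose $M'$ is $\mathrm{GF}(4)$-representable with reduced representation $M'=M[I\mid C']$, $C'=\begin{bmatrix} A' & \underline{1}\\ \underline{1}^{T} & \omega\end{bmatrix}$ with the same labels, where the $(f,e)$ entry is $\omega\in\mathrm{GF}(4)-\{0,1\}$ and all other entries of row $f$ and column $e$ are $1$. -}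

module Defs where

open import Level using (0ℓ)
open import Data.Nat using (ℕ; zero; suc)
open import Data.Fin using (Fin; zero; suc; fromℕ; inject₁)
open import Data.Sum using (_⊎_; inj₁; inj₂)
open import Data.Product using (_×_; ∃; _,_)
open import Relation.Binary.PropositionalEquality using (_≡_; _≢_)
open import Relation.Nullary using (¬_; yes; no)
open import Relation.Unary using (Pred; _⊆_; _≐_)
open import Data.Fin.Properties using () renaming (_≟_ to _≟F_)

data GF4 : Set where
  𝟎 𝟏 ω ω² : GF4

infixl 6 _⊕_
infixl 7 _⊗_

_⊕_ : GF4 → GF4 → GF4
𝟎  ⊕ y  = y
𝟏  ⊕ 𝟎  = 𝟏
𝟏  ⊕ 𝟏  = 𝟎
𝟏  ⊕ ω  = ω²
𝟏  ⊕ ω² = ω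
ω  ⊕ 𝟎  = ω
ω  ⊕ 𝟏  = ω²
ω  ⊕ ω  = 𝟎
ω  ⊕ ω² = 𝟏
ω² ⊕ 𝟎  = ω²
ω² ⊕ 𝟏  = ω
ω² ⊕ ω  = 𝟏
ω² ⊕ ω² = 𝟎

_⊗_ : GF4 → GF4 → GF4
𝟎  ⊗ y  = 𝟎
𝟏  ⊗ y  = y
ω  ⊗ 𝟎  = 𝟎
ω  ⊗ 𝟏  = ω
ω  ⊗ ω  = ω²
ω  ⊗ ω² = 𝟏
ω² ⊗ 𝟎  = 𝟎
ω² ⊗ 𝟏  = ω²
ω² ⊗ ω  = 𝟏
ω² ⊗ ω² = ω

sumFin : (n : ℕ) → (Fin n → GF4) → GF4
sumFin zero    g = 𝟎
sumFin (suc n) g = g zero ⊕ sumFin n (λ i → g (suc i))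

-- The matroid M[I | D] of a reduced p × q matrix D over GF(4).
-- Ground set: Fin p ⊎ Fin q; inj₁ i labels the i-th column of the
-- identity (= the row label i), inj₂ j labels the j-th column of D.

Ground : ℕ → ℕ → Set
Ground p q = Fin p ⊎ Fin q

module MatrixMatroid {p q : ℕ} (D : Fin p → Fin q → GF4) where

  E : Set
  E = Ground p q

  column : E → Fin p → GF4
  column (inj₁ i) r with i ≟F r
  ... | yes _ = 𝟏
  ... | no  _ = 𝟎
  column (inj₂ j) r = D r j

  sumE : (E → GF4) → GF4
  sumE g = sumFin p (λ i → g (inj₁ i)) ⊕ sumFin q (λ j → g (inj₂ j))

  Independent : Pred E 0ℓ → Set
  Independent S =
    (c : E → GF4) → (∀ x → c x ≢ 𝟎 → S x) →
    (∀ r → sumE (λ x → c x ⊗ column x r) ≡ 𝟎) → ∀ x → c x ≡ 𝟎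

  IsBasis : Pred E 0ℓ → Set₁
  IsBasis B = Independent B × (∀ T → B ⊆ T → Independent T → T ⊆ B)

  Spanning : Pred E 0ℓ → Set₁
  Spanning S = ∃ λ B → IsBasis B × B ⊆ S

  ProperSub : Pred E 0ℓ → Pred E 0ℓ → Set
  ProperSub S T = S ⊆ T × ∃ λ x → T x × ¬ S x

  IsCircuit : Pred E 0ℓ → Set₁
  IsCircuit C = ¬ Independent C × (∀ T → ProperSub T C → Independent T)

  IsHyperplane : Pred E 0ℓ → Set₁
  IsHyperplane H = ¬ Spanning H × (∀ T → ProperSub H T → Spanning T)

  IsCircuitHyperplane : Pred E 0ℓ → Set₁
  IsCircuitHyperplane X = IsCircuit X × IsHyperplane X

-- The block shape  C = [ A  1 ; 1ᵀ  c ]  with row f = last row (fromℕ m)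
-- and column e = last column (fromℕ k).

IsBlock : {m k : ℕ} → (Fin (suc m) → Fin (suc k) → GF4) →
          (Fin m → Fin k → GF4) → GF4 → Set
IsBlock {m} {k} C A c =
  (∀ i j → C (inject₁ i) (inject₁ j) ≡ A i j) ×
  (∀ i → C (inject₁ i) (fromℕ k) ≡ 𝟏) ×
  (∀ j → C (fromℕ m) (inject₁ j) ≡ 𝟏) ×
  C (fromℕ m) (fromℕ k) ≡ c

-- The set X = (X - e) ∪ e : all row labels except f, together with e.
Xset : (m k : ℕ) → Pred (Ground (suc m) (suc k)) 0ℓ
Xset m k (inj₁ i) = i ≢ fromℕ m
Xset m k (inj₂ j) = j ≡ fromℕ k

formI : GF4 → GF4 → Fin 3 → Fin 3 → GF4
formI x y zero zero = x
formI x y zero (suc zero) = y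
formI x y zero (suc (suc zero)) = x
formI x y (suc zero) zero = y
formI x y (suc zero) (suc zero) = y
formI x y (suc zero) (suc (suc zero)) = 𝟎
formI x y (suc (suc zero)) zero = x
formI x y (suc (suc zero)) (suc zero) = 𝟎
formI x y (suc (suc zero)) (suc (suc zero)) = 𝟎

formII : GF4 → GF4 → GF4 → Fin 3 → Fin 3 → GF4
formII x y z (suc (suc zero)) (suc (suc zero)) = z
formII x y z i j = formI x y i j

{-# OPTIONS --safe #-}
-- Exchanging the rows R of a square submatrix D[R,S] for its columns S turns the identity basis of
-- M[I | D] into a basis exactly when D[R,S] is invertible.  Since the bases of M′ are those of M
-- together with X, a square submatrix of C using a row other than f is invertible if and only if
-- the same submatrix of C′ is.  The 1 × 1 and 2 × 2 submatrices meeting row f or column e show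
-- that A′ has the zero pattern of A, repeats an entry along a row or column wherever A does, and
-- has no entry equal to w⁻¹.  On a configuration (i) or (ii) the submatrix of A′ therefore reads
-- [a b a; b b 0; a 0 d] with {a, b} = {1, w}, and a² + ab + b² = 0 produces a submatrix whose rank
-- differs between C and C′: the 4 × 4 one bordered by f and e in case (i), the 3 × 3 one in
-- case (ii).
module Submission where

open import Defs
open import Level using (0ℓ)
open import Data.Nat using (ℕ; zero; suc)
open import Data.Fin using (Fin; zero; suc; fromℕ; inject₁; punchIn)
open import Data.Fin.Patterns using (0F; 1F; 2F)
open import Data.Fin.Properties using (any?; all?; suc-injective; inject₁-injective; fromℕ≢inject₁)
  renaming (_≟_ to _≟F_)
open import Data.Sum using (_⊎_; inj₁; inj₂)
open import Data.Sum.Properties using (≡-dec)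
open import Data.Product using (_×_; _,_; ∃; proj₁; proj₂)
open import Data.Vec.Functional using ([]; _∷_)
open import Data.Bool using (if_then_else_)
open import Function using (id; _∘_)
open import Function.Bundles using (_⇔_; Equivalence)
open import Function.Definitions using (Injective)
open import Relation.Binary.Definitions using (DecidableEquality)
open import Relation.Binary.PropositionalEquality
  using (_≡_; _≢_; refl; sym; trans; cong; cong₂; subst; module ≡-Reasoning)
open import Relation.Binary.PropositionalEquality.Algebra using (isMagma)
open import Relation.Nullary using (Dec; yes; no; ¬_; does; contradiction)
open import Relation.Nullary.Decidable using (map′; _×-dec_; _→-dec_; ¬?; from-yes; decidable-stable)
open import Relation.Unary using (Pred; Decidable; _⊆_; _≐_)
open import Algebra.Bundles using (CommutativeSemiring)
open import Algebra.Structures.Biased using (isCommutativeMonoidˡ; isCommutativeSemiringˡ)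

-- Arithmetic in GF(4)

infix 4 _≟_
_≟_ : DecidableEquality GF4
𝟎  ≟ 𝟎  = yes refl
𝟎  ≟ 𝟏  = no λ ()
𝟎  ≟ ω  = no λ ()
𝟎  ≟ ω² = no λ ()
𝟏  ≟ 𝟎  = no λ ()
𝟏  ≟ 𝟏  = yes refl
𝟏  ≟ ω  = no λ ()
𝟏  ≟ ω² = no λ ()
ω  ≟ 𝟎  = no λ ()
ω  ≟ 𝟏  = no λ ()
ω  ≟ ω  = yes refl
ω  ≟ ω² = no λ ()
ω² ≟ 𝟎  = no λ ()
ω² ≟ 𝟏  = no λ ()
ω² ≟ ω  = no λ ()
ω² ≟ ω² = yes refl

∀? : {P : GF4 → Set} → Decidable P → Dec (∀ a → P a)
∀? P? = map′ (λ (p₀ , p₁ , p₂ , p₃) → λ { 𝟎 → p₀ ; 𝟏 → p₁ ; ω → p₂ ; ω² → p₃ })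
             (λ p → p 𝟎 , p 𝟏 , p ω , p ω²)
             (P? 𝟎 ×-dec P? 𝟏 ×-dec P? ω ×-dec P? ω²)

⊕-comm : ∀ a b → a ⊕ b ≡ b ⊕ a
⊕-comm = from-yes (∀? λ a → ∀? λ b → a ⊕ b ≟ b ⊕ a)

⊕-assoc : ∀ a b c → (a ⊕ b) ⊕ c ≡ a ⊕ (b ⊕ c)
⊕-assoc = from-yes (∀? λ a → ∀? λ b → ∀? λ c → (a ⊕ b) ⊕ c ≟ a ⊕ (b ⊕ c))

⊕-self : ∀ a → a ⊕ a ≡ 𝟎
⊕-self = from-yes (∀? λ a → a ⊕ a ≟ 𝟎)

⊕≡𝟎⇒≡ : ∀ a b → a ⊕ b ≡ 𝟎 → a ≡ b
⊕≡𝟎⇒≡ = from-yes (∀? λ a → ∀? λ b → (a ⊕ b ≟ 𝟎) →-dec (a ≟ b))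

⊗-comm : ∀ a b → a ⊗ b ≡ b ⊗ a
⊗-comm = from-yes (∀? λ a → ∀? λ b → a ⊗ b ≟ b ⊗ a)

⊗-assoc : ∀ a b c → (a ⊗ b) ⊗ c ≡ a ⊗ (b ⊗ c)
⊗-assoc = from-yes (∀? λ a → ∀? λ b → ∀? λ c → (a ⊗ b) ⊗ c ≟ a ⊗ (b ⊗ c))

⊗-distribʳ-⊕ : ∀ a b c → (b ⊕ c) ⊗ a ≡ b ⊗ a ⊕ c ⊗ a
⊗-distribʳ-⊕ = from-yes (∀? λ a → ∀? λ b → ∀? λ c → (b ⊕ c) ⊗ a ≟ b ⊗ a ⊕ c ⊗ a)

⊗-cancelˡ : ∀ c a b → c ≢ 𝟎 → c ⊗ a ≡ c ⊗ b → a ≡ b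
⊗-cancelˡ = from-yes (∀? λ c → ∀? λ a → ∀? λ b → ¬? (c ≟ 𝟎) →-dec (c ⊗ a ≟ c ⊗ b) →-dec (a ≟ b))

GF4-commutativeSemiring : CommutativeSemiring 0ℓ 0ℓ
GF4-commutativeSemiring = record
  { isCommutativeSemiring = isCommutativeSemiringˡ record
    { +-isCommutativeMonoid = isCommutativeMonoidˡ record
      { isSemigroup = record { isMagma = isMagma _⊕_ ; assoc = ⊕-assoc }
      ; identityˡ   = λ _ → refl
      ; comm        = ⊕-comm
      }
    ; *-isCommutativeMonoid = isCommutativeMonoidˡ record
      { isSemigroup = record { isMagma = isMagma _⊗_ ; assoc = ⊗-assoc }
      ; identityˡ   = λ _ → refl
      ; comm        = ⊗-comm
      }
    ; distribʳ = ⊗-distribʳ-⊕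
    ; zeroˡ    = λ _ → refl
    }
  }

open CommutativeSemiring GF4-commutativeSemiring
  using (semiring; +-identityʳ; *-identityʳ; zeroʳ; +-commutativeSemigroup)
open import Algebra.Properties.Semiring.Sum semiring
  using (sum; sum-cong-≗; sum-replicate-zero; ∑-distrib-+; ∑-comm; *-distribˡ-sum; *-distribʳ-sum)
open import Algebra.Properties.CommutativeSemigroup +-commutativeSemigroup using (interchange)

sumFin≡sum : ∀ n (g : Fin n → GF4) → sumFin n g ≡ sum g
sumFin≡sum zero    g = refl
sumFin≡sum (suc n) g = cong (g zero ⊕_) (sumFin≡sum n (g ∘ suc))

sum-zero : ∀ {n} {g : Fin n → GF4} → (∀ i → g i ≡ 𝟎) → sum g ≡ 𝟎
sum-zero {n} g≡0 = trans (sum-cong-≗ g≡0) (sum-replicate-zero n)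

δ[_] : {A : Set} → DecidableEquality A → A → A → GF4
δ[ _≟ᴬ_ ] a b = if does (a ≟ᴬ b) then 𝟏 else 𝟎

module _ {A : Set} (_≟ᴬ_ : DecidableEquality A) where

  δ[]-refl : ∀ a → δ[ _≟ᴬ_ ] a a ≡ 𝟏
  δ[]-refl a with a ≟ᴬ a
  ... | yes _   = refl
  ... | no a≢a = contradiction refl a≢a

  δ[]-≢ : ∀ {a b} → a ≢ b → δ[ _≟ᴬ_ ] a b ≡ 𝟎
  δ[]-≢ {a} {b} a≢b with a ≟ᴬ b
  ... | yes a≡b = contradiction a≡b a≢b
  ... | no _    = refl

  δ[]≢𝟎⇒≡ : ∀ {a b} → δ[ _≟ᴬ_ ] a b ≢ 𝟎 → a ≡ b
  δ[]≢𝟎⇒≡ {a} {b} δ≢0 with a ≟ᴬ b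
  ... | yes a≡b = a≡b
  ... | no _    = contradiction refl δ≢0

  δ[]-cong : ∀ {B : Set} (_≟ᴮ_ : DecidableEquality B) {a a′ : A} {b b′ : B} →
             (a ≡ a′ → b ≡ b′) → (b ≡ b′ → a ≡ a′) → δ[ _≟ᴬ_ ] a a′ ≡ δ[ _≟ᴮ_ ] b b′
  δ[]-cong _≟ᴮ_ {a} {a′} {b} {b′} to from with a ≟ᴬ a′ | b ≟ᴮ b′
  ... | yes _    | yes _    = refl
  ... | yes a≡a′ | no b≢b′ = contradiction (to a≡a′) b≢b′
  ... | no a≢a′ | yes b≡b′ = contradiction (from b≡b′) a≢a′
  ... | no _     | no _     = refl

δ : ∀ {n} → Fin n → Fin n → GF4
δ = δ[ _≟F_ ]

δ-sym : ∀ {n} (a b : Fin n) → δ a b ≡ δ b a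
δ-sym a b = δ[]-cong _≟F_ _≟F_ {a} {b} {b} {a} sym sym

sum-δ : ∀ {n} (k : Fin n) (g : Fin n → GF4) → sum (λ j → δ k j ⊗ g j) ≡ g k
sum-δ {suc n} zero    g = trans (cong (g zero ⊕_) (sum-replicate-zero n)) (+-identityʳ (g zero))
sum-δ         (suc k) g = sum-δ k (g ∘ suc)

-- Matrices over GF(4)

Mat : ℕ → Set
Mat n = Fin n → Fin n → GF4

submatrix : ∀ {p q n} → (Fin p → Fin q → GF4) → (Fin n → Fin p) → (Fin n → Fin q) → Mat n
submatrix D R S a b = D (R a) (S b)

infixl 7 _·_ _·ᵥ_

_·ᵥ_ : ∀ {n} → Mat n → (Fin n → GF4) → Fin n → GF4
(M ·ᵥ v) a = sum (λ l → M a l ⊗ v l)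

_·_ : ∀ {n} → Mat n → Mat n → Mat n
(M · N) a b = sum (λ l → M a l ⊗ N l b)

IsInverse : ∀ {n} → Mat n → Mat n → Set
IsInverse M N = (∀ a b → (M · N) a b ≡ δ a b) × (∀ a b → (N · M) a b ≡ δ a b)

IsKernelVector : ∀ {n} → Mat n → (Fin n → GF4) → Set
IsKernelVector M v = ∀ a → (M ·ᵥ v) a ≡ 𝟎

record Invertible {n} (M : Mat n) : Set where
  constructor invertible
  field
    inverse    : Mat n
    is-inverse : IsInverse M inverse

record Singular {n} (M : Mat n) : Set where
  constructor singular
  field
    vector    : Fin n → GF4
    nonzero   : ∃ λ l → vector l ≢ 𝟎
    in-kernel : IsKernelVector M vector

isInverse? : ∀ {n} (M N : Mat n) → Dec (IsInverse M N)
isInverse? M N = all? (λ a → all? λ b → (M · N) a b ≟ δ a b)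
           ×-dec all? (λ a → all? λ b → (N · M) a b ≟ δ a b)

isKernelVector? : ∀ {n} (M : Mat n) v → Dec (IsKernelVector M v)
isKernelVector? M v = all? λ a → (M ·ᵥ v) a ≟ 𝟎

Invertible-resp : ∀ {n} {M M′ : Mat n} → (∀ a b → M a b ≡ M′ a b) → Invertible M → Invertible M′
Invertible-resp M≗M′ (invertible N (MN≡1 , NM≡1)) =
  invertible N ((λ a b → trans (sum-cong-≗ λ l → cong (_⊗ N l b) (sym (M≗M′ a l))) (MN≡1 a b))
    , (λ a b → trans (sum-cong-≗ λ l → cong (N a l ⊗_) (sym (M≗M′ l b))) (NM≡1 a b)))

Singular-resp : ∀ {n} {M M′ : Mat n} → (∀ a b → M a b ≡ M′ a b) → Singular M → Singular M′
Singular-resp M≗M′ (singular v v≢0 Mv≡0) =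
  singular v v≢0 λ a → trans (sum-cong-≗ λ l → cong (_⊗ v l) (sym (M≗M′ a l))) (Mv≡0 a)

·ᵥ-assoc : ∀ {n} (M N : Mat n) v a → (M · N ·ᵥ v) a ≡ (M ·ᵥ (N ·ᵥ v)) a
·ᵥ-assoc M N v a = begin
  sum (λ l → sum (λ k → M a k ⊗ N k l) ⊗ v l)
    ≡⟨ sum-cong-≗ (λ l → *-distribʳ-sum (v l) λ k → M a k ⊗ N k l) ⟩
  sum (λ l → sum (λ k → M a k ⊗ N k l ⊗ v l))
    ≡⟨ ∑-comm (λ l k → M a k ⊗ N k l ⊗ v l) ⟩
  sum (λ k → sum (λ l → M a k ⊗ N k l ⊗ v l))
    ≡⟨ sum-cong-≗ (λ k → sum-cong-≗ λ l → ⊗-assoc (M a k) (N k l) (v l)) ⟩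
  sum (λ k → sum (λ l → M a k ⊗ (N k l ⊗ v l)))
    ≡⟨ sum-cong-≗ (λ k → *-distribˡ-sum (M a k) λ l → N k l ⊗ v l) ⟨
  sum (λ k → M a k ⊗ sum (λ l → N k l ⊗ v l)) ∎
  where open ≡-Reasoning

right-inverse-·ᵥ : ∀ {n} {M N : Mat n} → (∀ a b → (M · N) a b ≡ δ a b) → ∀ v a → (M ·ᵥ (N ·ᵥ v)) a ≡ v a
right-inverse-·ᵥ {M = M} {N} MN≡1 v a =
  trans (sym (·ᵥ-assoc M N v a)) (trans (sum-cong-≗ λ l → cong (_⊗ v l) (MN≡1 a l)) (sum-δ a v))

left-invertible⇒trivial-kernel : ∀ {n} {M N : Mat n} → (∀ a b → (N · M) a b ≡ δ a b) →
                                 ∀ {v} → IsKernelVector M v → ∀ l → v l ≡ 𝟎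
left-invertible⇒trivial-kernel {N = N} NM≡1 {v} Mv≡0 l =
  trans (sym (right-inverse-·ᵥ NM≡1 v l))
        (sum-zero λ a → trans (cong (N l a ⊗_) (Mv≡0 a)) (zeroʳ (N l a)))

-- No signs: GF(4) has characteristic 2.
det : ∀ {n} → Mat n → GF4
det {zero}  M = 𝟏
det {suc n} M = sum λ j → M zero j ⊗ det (λ a b → M (suc a) (punchIn j b))

adjugate : ∀ {n} → Mat (suc n) → Mat (suc n)
adjugate M a b = det (λ i j → M (punchIn b i) (punchIn a j))

_⁻¹ : GF4 → GF4
𝟎 ⁻¹  = 𝟎
𝟏 ⁻¹  = 𝟏
ω ⁻¹  = ω²
ω² ⁻¹ = ω

adjugate-inverse : ∀ {n} → Mat (suc n) → Mat (suc n)
adjugate-inverse M a b = det M ⁻¹ ⊗ adjugate M a b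

mat₁ : GF4 → Mat 1
mat₁ p = (p ∷ []) ∷ []

mat₂ : GF4 → GF4 → GF4 → GF4 → Mat 2
mat₂ p q r s = (p ∷ q ∷ []) ∷ (r ∷ s ∷ []) ∷ []

invertible₁ : (M : Mat 1) → M 0F 0F ≢ 𝟎 → Invertible M
invertible₁ M M≢0 = Invertible-resp M≗ (invertible (adjugate-inverse (mat₁ (M 0F 0F))) (certificate _ M≢0))
  where
  certificate : ∀ p → p ≢ 𝟎 → IsInverse (mat₁ p) (adjugate-inverse (mat₁ p))
  certificate = from-yes (∀? λ p → ¬? (p ≟ 𝟎) →-dec isInverse? (mat₁ p) (adjugate-inverse (mat₁ p)))
  M≗ : ∀ a b → mat₁ (M 0F 0F) a b ≡ M a b
  M≗ 0F 0F = refl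

singular₁ : (M : Mat 1) → M 0F 0F ≡ 𝟎 → Singular M
singular₁ M M≡0 = singular (λ _ → 𝟏) (0F , λ ()) λ { 0F → cong (_⊕ 𝟎) (trans (*-identityʳ _) M≡0) }

invertible₂ : (M : Mat 2) → M 0F 0F ⊗ M 1F 1F ≢ M 0F 1F ⊗ M 1F 0F → Invertible M
invertible₂ M ps≢qr = Invertible-resp M≗ (invertible (adjugate-inverse M̂) (certificate _ _ _ _ ps≢qr))
  where
  M̂ : Mat 2
  M̂ = mat₂ (M 0F 0F) (M 0F 1F) (M 1F 0F) (M 1F 1F)
  certificate : ∀ p q r s → p ⊗ s ≢ q ⊗ r → IsInverse (mat₂ p q r s) (adjugate-inverse (mat₂ p q r s))
  certificate = from-yes (∀? λ p → ∀? λ q → ∀? λ r → ∀? λ s →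
    ¬? (p ⊗ s ≟ q ⊗ r) →-dec isInverse? (mat₂ p q r s) (adjugate-inverse (mat₂ p q r s)))
  M≗ : ∀ a b → M̂ a b ≡ M a b
  M≗ 0F 0F = refl
  M≗ 0F 1F = refl
  M≗ 1F 0F = refl
  M≗ 1F 1F = refl

singular₂ : (M : Mat 2) → M 0F 0F ⊗ M 1F 1F ≡ M 0F 1F ⊗ M 1F 0F → M 0F 0F ≢ 𝟎 ⊎ M 0F 1F ≢ 𝟎 → Singular M
singular₂ M ps≡qr first-row≢0 = singular (M 0F 1F ∷ M 0F 0F ∷ []) (nonzero-entry first-row≢0) kernel
  where
  nonzero-entry : M 0F 0F ≢ 𝟎 ⊎ M 0F 1F ≢ 𝟎 → ∃ λ l → (M 0F 1F ∷ M 0F 0F ∷ []) l ≢ 𝟎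
  nonzero-entry (inj₁ p≢0) = 1F , p≢0
  nonzero-entry (inj₂ q≢0) = 0F , q≢0
  mat₂-kernel : ∀ p q r s → p ⊗ s ≡ q ⊗ r → IsKernelVector (mat₂ p q r s) (q ∷ p ∷ [])
  mat₂-kernel = from-yes (∀? λ p → ∀? λ q → ∀? λ r → ∀? λ s →
    (p ⊗ s ≟ q ⊗ r) →-dec isKernelVector? (mat₂ p q r s) (q ∷ p ∷ []))
  kernel : IsKernelVector M (M 0F 1F ∷ M 0F 0F ∷ [])
  kernel 0F = mat₂-kernel _ _ (M 1F 0F) (M 1F 1F) ps≡qr 0F
  kernel 1F = mat₂-kernel _ _ (M 1F 0F) (M 1F 1F) ps≡qr 1F

-- Bases of M[I | D]

exchange : ∀ {p q n} → (Fin n → Fin p) → (Fin n → Fin q) → Pred (Ground p q) 0ℓ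
exchange R S (inj₁ i) = ¬ (∃ λ l → R l ≡ i)
exchange R S (inj₂ j) = ∃ λ l → S l ≡ j

image? : ∀ {n m} (S : Fin n → Fin m) j → Dec (∃ λ l → S l ≡ j)
image? S j = any? λ l → S l ≟F j

exchange? : ∀ {p q n} (R : Fin n → Fin p) (S : Fin n → Fin q) → Decidable (exchange R S)
exchange? R S (inj₁ i) = ¬? (image? R i)
exchange? R S (inj₂ j) = image? S j

module Representation {p q : ℕ} (D : Fin p → Fin q → GF4) where
  open MatrixMatroid D

  combination : (E → GF4) → Fin p → GF4
  combination κ r = sumE λ x → κ x ⊗ column x r

  column-inj₁ : ∀ i r → column (inj₁ i) r ≡ δ i r
  column-inj₁ i r with i ≟F r
  ... | yes _ = refl
  ... | no _  = refl

  combination-split : ∀ κ r → combination κ r ≡ κ (inj₁ r) ⊕ sum (λ j → κ (inj₂ j) ⊗ D r j)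
  combination-split κ r = cong₂ _⊕_ identity-part (sumFin≡sum q _)
    where
    identity-part : sumFin p (λ i → κ (inj₁ i) ⊗ column (inj₁ i) r) ≡ κ (inj₁ r)
    identity-part = trans (sumFin≡sum p _) (trans (sum-cong-≗ λ i →
      trans (cong (κ (inj₁ i) ⊗_) (trans (column-inj₁ i r) (δ-sym i r))) (⊗-comm (κ (inj₁ i)) (δ r i)))
      (sum-δ r (κ ∘ inj₁)))

  combination-⊕ : ∀ κ κ′ r → combination (λ x → κ x ⊕ κ′ x) r ≡ combination κ r ⊕ combination κ′ r
  combination-⊕ κ κ′ r = begin
    combination (λ x → κ x ⊕ κ′ x) r
      ≡⟨ combination-split (λ x → κ x ⊕ κ′ x) r ⟩
    (κ (inj₁ r) ⊕ κ′ (inj₁ r)) ⊕ sum (λ j → (κ (inj₂ j) ⊕ κ′ (inj₂ j)) ⊗ D r j)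
      ≡⟨ cong (_ ⊕_) (trans (sum-cong-≗ λ j → ⊗-distribʳ-⊕ (D r j) (κ (inj₂ j)) (κ′ (inj₂ j)))
                            (∑-distrib-+ (columns κ) (columns κ′))) ⟩
    (κ (inj₁ r) ⊕ κ′ (inj₁ r)) ⊕ (sum (columns κ) ⊕ sum (columns κ′))
      ≡⟨ interchange (κ (inj₁ r)) (κ′ (inj₁ r)) (sum (columns κ)) (sum (columns κ′)) ⟩
    (κ (inj₁ r) ⊕ sum (columns κ)) ⊕ (κ′ (inj₁ r) ⊕ sum (columns κ′))
      ≡⟨ cong₂ _⊕_ (combination-split κ r) (combination-split κ′ r) ⟨
    combination κ r ⊕ combination κ′ r ∎
    where
    open ≡-Reasoning
    columns : (E → GF4) → Fin q → GF4
    columns κ j = κ (inj₂ j) ⊗ D r j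

  _≟E_ : DecidableEquality E
  _≟E_ = ≡-dec _≟F_ _≟F_

  combination-unit : ∀ x r → combination (δ[ _≟E_ ] x) r ≡ column x r
  combination-unit (inj₁ i) r = trans (combination-split (δ[ _≟E_ ] (inj₁ i)) r)
    (trans (cong (δ i r ⊕_) (sum-zero {q} λ _ → refl)) (trans (+-identityʳ (δ i r)) (sym (column-inj₁ i r))))
  combination-unit (inj₂ j) r = trans (combination-split (δ[ _≟E_ ] (inj₂ j)) r) (sum-δ j (D r))

  coordinates : E → E → GF4
  coordinates x (inj₁ i) = column x i
  coordinates x (inj₂ j) = 𝟎

  combination-coordinates : ∀ x r → combination (coordinates x) r ≡ column x r
  combination-coordinates x r = trans (combination-split (coordinates x) r)
    (trans (cong (column x r ⊕_) (sum-zero {q} λ _ → refl)) (+-identityʳ (column x r)))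

  -- The columns S weighted by u equal the identity columns weighted by D[-,S] u; in characteristic 2
  -- the two sides together form a vanishing combination.
  relation : ∀ {n} → (Fin n → Fin q) → (Fin n → GF4) → E → GF4
  relation S u (inj₁ i) = sum λ l → D i (S l) ⊗ u l
  relation S u (inj₂ j) = sum λ l → δ (S l) j ⊗ u l

  relation-columns : ∀ {n} (S : Fin n → Fin q) u r →
                     sum (λ j → relation S u (inj₂ j) ⊗ D r j) ≡ relation S u (inj₁ r)
  relation-columns S u r = begin
    sum (λ j → sum (λ l → δ (S l) j ⊗ u l) ⊗ D r j)
      ≡⟨ sum-cong-≗ (λ j → *-distribʳ-sum (D r j) λ l → δ (S l) j ⊗ u l) ⟩
    sum (λ j → sum (λ l → δ (S l) j ⊗ u l ⊗ D r j))
      ≡⟨ ∑-comm (λ j l → δ (S l) j ⊗ u l ⊗ D r j) ⟩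
    sum (λ l → sum (λ j → δ (S l) j ⊗ u l ⊗ D r j))
      ≡⟨ sum-cong-≗ (λ l → sum-cong-≗ λ j → ⊗-assoc (δ (S l) j) (u l) (D r j)) ⟩
    sum (λ l → sum (λ j → δ (S l) j ⊗ (u l ⊗ D r j)))
      ≡⟨ sum-cong-≗ (λ l → trans (sum-δ (S l) λ j → u l ⊗ D r j) (⊗-comm (u l) (D r (S l)))) ⟩
    sum (λ l → D r (S l) ⊗ u l) ∎
    where open ≡-Reasoning

  relation-dependency : ∀ {n} (S : Fin n → Fin q) u r → combination (relation S u) r ≡ 𝟎
  relation-dependency S u r = trans (combination-split (relation S u) r)
    (trans (cong (relation S u (inj₁ r) ⊕_) (relation-columns S u r)) (⊕-self (relation S u (inj₁ r))))

  relation-at : ∀ {n} {S : Fin n → Fin q} → Injective _≡_ _≡_ S → ∀ u l → relation S u (inj₂ (S l)) ≡ u l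
  relation-at {S = S} S-inj u l =
    trans (sum-cong-≗ λ l′ → cong (_⊗ u l′) (δ[]-cong _≟F_ _≟F_ {S l′} {S l} {l} {l′} (sym ∘ S-inj) (cong S ∘ sym)))
          (sum-δ l u)

  relation-outside : ∀ {n} (S : Fin n → Fin q) u j → ¬ (∃ λ l → S l ≡ j) → relation S u (inj₂ j) ≡ 𝟎
  relation-outside S u j j∉S = sum-zero λ l → cong (_⊗ u l) (δ[]-≢ _≟F_ λ Sl≡j → j∉S (l , Sl≡j))

  module _ {n} (R : Fin n → Fin p) (S : Fin n → Fin q) (S-inj : Injective _≡_ _≡_ S) where

    singular⇒dependent : Singular (submatrix D R S) → ¬ Independent (exchange R S)
    singular⇒dependent (singular v (l , vl≢0) Mv≡0) indep =
      vl≢0 (trans (sym (relation-at S-inj v l))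
                  (indep (relation S v) support (relation-dependency S v) (inj₂ (S l))))
      where
      support : ∀ x → relation S v x ≢ 𝟎 → exchange R S x
      support (inj₁ i) ≢0 (a , refl) = ≢0 (Mv≡0 a)
      support (inj₂ j) ≢0 = decidable-stable (image? S j) (≢0 ∘ relation-outside S v j)

    module _ (M-inv : Invertible (submatrix D R S)) where
      open Invertible M-inv renaming (inverse to N)

      independent : Independent (exchange R S)
      independent κ support dependency = κ≡0
        where
        vanishes : ∀ x → ¬ exchange R S x → κ x ≡ 𝟎
        vanishes x x∉B = decidable-stable (κ x ≟ 𝟎) (x∉B ∘ support x)
        v : Fin n → GF4
        v l = κ (inj₂ (S l))
        columns : ∀ j → relation S v (inj₂ j) ≡ κ (inj₂ j)
        columns j with image? S j
        ... | yes (l , refl) = relation-at S-inj v l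
        ... | no j∉S = trans (relation-outside S v j j∉S) (sym (vanishes (inj₂ j) j∉S))
        rows : ∀ r → κ (inj₁ r) ≡ relation S v (inj₁ r)
        rows r = ⊕≡𝟎⇒≡ _ _ (begin
          κ (inj₁ r) ⊕ relation S v (inj₁ r)
            ≡⟨ cong (_ ⊕_) (relation-columns S v r) ⟨
          κ (inj₁ r) ⊕ sum (λ j → relation S v (inj₂ j) ⊗ D r j)
            ≡⟨ cong (_ ⊕_) (sum-cong-≗ λ j → cong (_⊗ D r j) (columns j)) ⟩
          κ (inj₁ r) ⊕ sum (λ j → κ (inj₂ j) ⊗ D r j)
            ≡⟨ combination-split κ r ⟨
          combination κ r
            ≡⟨ dependency r ⟩
          𝟎 ∎)
          where open ≡-Reasoning
        v≡0 : ∀ l → v l ≡ 𝟎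
        v≡0 = left-invertible⇒trivial-kernel (proj₂ is-inverse) λ a →
          trans (sym (rows (R a))) (vanishes (inj₁ (R a)) λ R∌ → R∌ (a , refl))
        relation≡0 : ∀ x → relation S v x ≡ 𝟎
        relation≡0 (inj₁ i) = sum-zero λ l → trans (cong (_ ⊗_) (v≡0 l)) (zeroʳ _)
        relation≡0 (inj₂ j) = sum-zero λ l → trans (cong (_ ⊗_) (v≡0 l)) (zeroʳ _)
        κ≡0 : ∀ x → κ x ≡ 𝟎
        κ≡0 (inj₁ r) = trans (rows r) (relation≡0 (inj₁ r))
        κ≡0 (inj₂ j) = trans (sym (columns j)) (relation≡0 (inj₂ j))

      -- x₀ is expressed through the identity columns, and those in R through the columns S.
      no-independent-extension : ∀ x₀ → ¬ exchange R S x₀ → ∀ T → exchange R S ⊆ T → T x₀ → ¬ Independent T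
      no-independent-extension x₀ x₀∉B T B⊆T x₀∈T indep =
        contradiction (trans (sym κx₀≡1) (indep κ support dependency x₀)) λ ()
        where
        u : Fin n → GF4
        u = N ·ᵥ λ a → column x₀ (R a)
        κ : E → GF4
        κ x = δ[ _≟E_ ] x₀ x ⊕ (relation S u x ⊕ coordinates x₀ x)
        balanced : ∀ x → ¬ exchange R S x → relation S u x ⊕ coordinates x₀ x ≡ 𝟎
        balanced (inj₁ i) x∉B with image? R i
        ... | yes (a , refl) =
          trans (cong (_⊕ column x₀ (R a)) (right-inverse-·ᵥ (proj₁ is-inverse) (λ b → column x₀ (R b)) a))
                (⊕-self (column x₀ (R a)))
        ... | no R∌i = contradiction R∌i x∉B
        balanced (inj₂ j) j∉S = trans (+-identityʳ _) (relation-outside S u j j∉S)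
        κ-off-B : ∀ x → ¬ exchange R S x → κ x ≡ δ[ _≟E_ ] x₀ x
        κ-off-B x x∉B = trans (cong (δ[ _≟E_ ] x₀ x ⊕_) (balanced x x∉B)) (+-identityʳ _)
        κx₀≡1 : κ x₀ ≡ 𝟏
        κx₀≡1 = trans (κ-off-B x₀ x₀∉B) (δ[]-refl _≟E_ x₀)
        support : ∀ x → κ x ≢ 𝟎 → T x
        support x κx≢0 with exchange? R S x
        ... | yes x∈B = B⊆T x∈B
        ... | no x∉B = subst T (δ[]≢𝟎⇒≡ _≟E_ (subst (_≢ 𝟎) (κ-off-B x x∉B) κx≢0)) x₀∈T
        dependency : ∀ r → combination κ r ≡ 𝟎
        dependency r = begin
          combination κ r
            ≡⟨ combination-⊕ (δ[ _≟E_ ] x₀) (λ x → relation S u x ⊕ coordinates x₀ x) r ⟩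
          combination (δ[ _≟E_ ] x₀) r ⊕ combination (λ x → relation S u x ⊕ coordinates x₀ x) r
            ≡⟨ cong₂ _⊕_ (combination-unit x₀ r) (combination-⊕ (relation S u) (coordinates x₀) r) ⟩
          column x₀ r ⊕ (combination (relation S u) r ⊕ combination (coordinates x₀) r)
            ≡⟨ cong (column x₀ r ⊕_) (cong₂ _⊕_ (relation-dependency S u r) (combination-coordinates x₀ r)) ⟩
          column x₀ r ⊕ column x₀ r
            ≡⟨ ⊕-self (column x₀ r) ⟩
          𝟎 ∎
          where open ≡-Reasoning

      invertible⇒basis : IsBasis (exchange R S)
      invertible⇒basis = independent , maximal
        where
        maximal : ∀ T → exchange R S ⊆ T → Independent T → T ⊆ exchange R S
        maximal T B⊆T indep {x} x∈T =
          decidable-stable (exchange? R S x) λ x∉B → no-independent-extension x x∉B T B⊆T x∈T indep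

-- Submatrices bordered by row f and column e

border : ∀ {s m} → (Fin s → Fin m) → Fin (suc s) → Fin (suc m)
border r zero    = fromℕ _
border r (suc i) = inject₁ (r i)

border-injective : ∀ {s m} {r : Fin s → Fin m} → Injective _≡_ _≡_ r → Injective _≡_ _≡_ (border r)
border-injective r-inj {zero}  {zero}  _  = refl
border-injective r-inj {zero}  {suc j} eq = contradiction eq fromℕ≢inject₁
border-injective r-inj {suc i} {zero}  eq = contradiction (sym eq) fromℕ≢inject₁
border-injective r-inj {suc i} {suc j} eq = cong suc (r-inj (inject₁-injective eq))

border-≢fromℕ : ∀ {s m} (r : Fin s → Fin m) {a} → a ≢ zero → border r a ≢ fromℕ m
border-≢fromℕ r {zero}  a≢0 = contradiction refl a≢0
border-≢fromℕ r {suc i} _   = fromℕ≢inject₁ ∘ sym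

bordered : ∀ {s t} → GF4 → (Fin s → Fin t → GF4) → Fin (suc s) → Fin (suc t) → GF4
bordered d G zero    zero    = d
bordered d G zero    (suc j) = 𝟏
bordered d G (suc i) zero    = 𝟏
bordered d G (suc i) (suc j) = G i j

bordered-cong : ∀ {s t} d {G H : Fin s → Fin t → GF4} → (∀ i j → G i j ≡ H i j) →
                ∀ a b → bordered d G a b ≡ bordered d H a b
bordered-cong d G≗H zero    zero    = refl
bordered-cong d G≗H zero    (suc j) = refl
bordered-cong d G≗H (suc i) zero    = refl
bordered-cong d G≗H (suc i) (suc j) = G≗H i j

bordered-block : ∀ {m k s t} {C : Fin (suc m) → Fin (suc k) → GF4} {A d} → IsBlock C A d →
                 (r : Fin s → Fin m) (c : Fin t → Fin k) →
                 ∀ a b → C (border r a) (border c b) ≡ bordered d (λ i j → A (r i) (c j)) a b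
bordered-block (_ , _ , _ , corner)   r c zero    zero    = corner
bordered-block (_ , _ , row-f , _)    r c zero    (suc j) = row-f (c j)
bordered-block (_ , column-e , _ , _) r c (suc i) zero    = column-e (r i)
bordered-block (block , _ , _ , _)    r c (suc i) (suc j) = block (r i) (c j)

singleton-injective : ∀ {n} (a : Fin n) → Injective _≡_ _≡_ (a ∷ [])
singleton-injective a {0F} {0F} _ = refl

pair-injective : ∀ {n} {a b : Fin n} → a ≢ b → Injective _≡_ _≡_ (a ∷ b ∷ [])
pair-injective a≢b {0F} {0F} _  = refl
pair-injective a≢b {0F} {1F} eq = contradiction eq a≢b
pair-injective a≢b {1F} {0F} eq = contradiction (sym eq) a≢b
pair-injective a≢b {1F} {1F} _  = refl

formI≗formII : ∀ x y i j → formI x y i j ≡ formII x y 𝟎 i j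
formI≗formII x y 0F j  = refl
formI≗formII x y 1F j  = refl
formI≗formII x y 2F 0F = refl
formI≗formII x y 2F 1F = refl
formI≗formII x y 2F 2F = refl

-- Uses x² + xy + y² = 0 for distinct non-zero x, y.
formI-bordered-kernel : ∀ x y → x ≢ 𝟎 → y ≢ 𝟎 → x ≢ y →
                        IsKernelVector (bordered 𝟎 (formII x y 𝟎)) (x ⊗ y ∷ y ∷ x ⊕ y ∷ x ∷ [])
formI-bordered-kernel = from-yes (∀? λ x → ∀? λ y → ¬? (x ≟ 𝟎) →-dec ¬? (y ≟ 𝟎) →-dec ¬? (x ≟ y) →-dec
  isKernelVector? (bordered 𝟎 (formII x y 𝟎)) (x ⊗ y ∷ y ∷ x ⊕ y ∷ x ∷ []))

formI-bordered-invertible : ∀ w a b → w ≢ 𝟎 → w ≢ 𝟏 → a ≢ 𝟎 → b ≢ 𝟎 → a ⊗ w ≢ 𝟏 → b ⊗ w ≢ 𝟏 → a ≢ b →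
                            Invertible (bordered w (formII a b 𝟎))
formI-bordered-invertible w a b w≢0 w≢1 a≢0 b≢0 aw≢1 bw≢1 a≢b =
  invertible (adjugate-inverse L) (certificate w a b w≢0 w≢1 a≢0 b≢0 aw≢1 bw≢1 a≢b)
  where
  L = bordered w (formII a b 𝟎)
  certificate : ∀ w a b → w ≢ 𝟎 → w ≢ 𝟏 → a ≢ 𝟎 → b ≢ 𝟎 → a ⊗ w ≢ 𝟏 → b ⊗ w ≢ 𝟏 → a ≢ b →
                IsInverse (bordered w (formII a b 𝟎)) (adjugate-inverse (bordered w (formII a b 𝟎)))
  certificate = from-yes (∀? λ w → ∀? λ a → ∀? λ b →
    ¬? (w ≟ 𝟎) →-dec ¬? (w ≟ 𝟏) →-dec ¬? (a ≟ 𝟎) →-dec ¬? (b ≟ 𝟎) →-dec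
    ¬? (a ⊗ w ≟ 𝟏) →-dec ¬? (b ⊗ w ≟ 𝟏) →-dec ¬? (a ≟ b) →-dec
    isInverse? (bordered w (formII a b 𝟎)) (adjugate-inverse (bordered w (formII a b 𝟎))))

formII-invertible : ∀ x y z → x ≢ 𝟎 → y ≢ 𝟎 → z ≢ 𝟎 → x ≢ y → x ≢ z → y ≢ z → Invertible (formII x y z)
formII-invertible x y z x≢0 y≢0 z≢0 x≢y x≢z y≢z =
  invertible (adjugate-inverse (formII x y z)) (certificate x y z x≢0 y≢0 z≢0 x≢y x≢z y≢z)
  where
  certificate : ∀ x y z → x ≢ 𝟎 → y ≢ 𝟎 → z ≢ 𝟎 → x ≢ y → x ≢ z → y ≢ z →
                IsInverse (formII x y z) (adjugate-inverse (formII x y z))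
  certificate = from-yes (∀? λ x → ∀? λ y → ∀? λ z →
    ¬? (x ≟ 𝟎) →-dec ¬? (y ≟ 𝟎) →-dec ¬? (z ≟ 𝟎) →-dec ¬? (x ≟ y) →-dec ¬? (x ≟ z) →-dec ¬? (y ≟ z) →-dec
    isInverse? (formII x y z) (adjugate-inverse (formII x y z)))

-- The hypotheses force {a, b} = {1, w} and d = b, so that a² + ab + b² = 0.
formII-kernel : ∀ w a b d → w ≢ 𝟎 → w ≢ 𝟏 → a ≢ 𝟎 → b ≢ 𝟎 → d ≢ 𝟎 →
                a ⊗ w ≢ 𝟏 → b ⊗ w ≢ 𝟏 → d ⊗ w ≢ 𝟏 → a ≢ b → a ≢ d →
                IsKernelVector (formII a b d) (b ∷ b ∷ a ∷ [])
formII-kernel = from-yes (∀? λ w → ∀? λ a → ∀? λ b → ∀? λ d →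
  ¬? (w ≟ 𝟎) →-dec ¬? (w ≟ 𝟏) →-dec ¬? (a ≟ 𝟎) →-dec ¬? (b ≟ 𝟎) →-dec ¬? (d ≟ 𝟎) →-dec
  ¬? (a ⊗ w ≟ 𝟏) →-dec ¬? (b ⊗ w ≟ 𝟏) →-dec ¬? (d ⊗ w ≟ 𝟏) →-dec ¬? (a ≟ b) →-dec ¬? (a ≟ d) →-dec
  isKernelVector? (formII a b d) (b ∷ b ∷ a ∷ []))

-- Relaxing the circuit-hyperplane X

module Relaxation {m k : ℕ} (A A′ : Fin m → Fin k → GF4) (C C′ : Fin (suc m) → Fin (suc k) → GF4) {w : GF4}
  (C-block : IsBlock C A 𝟎) (C′-block : IsBlock C′ A′ w)
  (bases : ∀ B → MatrixMatroid.IsBasis C′ B ⇔ (MatrixMatroid.IsBasis C B ⊎ B ≐ Xset m k)) where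

  module _ {n} (R : Fin n → Fin (suc m)) (S : Fin n → Fin (suc k)) (S-inj : Injective _≡_ _≡_ S) where

    basis-preserved : Invertible (submatrix C R S) → ¬ Singular (submatrix C′ R S)
    basis-preserved M-inv M′-sing = Representation.singular⇒dependent C′ R S S-inj M′-sing
      (proj₁ (Equivalence.from (bases _) (inj₁ (Representation.invertible⇒basis C R S S-inj M-inv))))

    non-basis-preserved : (∃ λ l → R l ≢ fromℕ m) → Singular (submatrix C R S) → ¬ Invertible (submatrix C′ R S)
    non-basis-preserved (l , Rl≢f) M-sing M′-inv
      with Equivalence.to (bases _) (Representation.invertible⇒basis C′ R S S-inj M′-inv)
    ... | inj₁ basis       = Representation.singular⇒dependent C R S S-inj M-sing (proj₁ basis)
    ... | inj₂ (_ , X⊆B) = X⊆B {inj₁ (R l)} Rl≢f (l , refl)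

  module Bordered {s t} (r : Fin s → Fin m) {c : Fin t → Fin k} (c-inj : Injective _≡_ _≡_ c)
    {F : Fin s → Fin t → GF4} (A≗F : ∀ i j → A (r i) (c j) ≡ F i j) where

    G : Fin s → Fin t → GF4
    G i j = A′ (r i) (c j)

    N N′ : Fin (suc s) → Fin (suc t) → GF4
    N  = bordered 𝟎 F
    N′ = bordered w G

    N-local : ∀ a b → C (border r a) (border c b) ≡ N a b
    N-local a b = trans (bordered-block {C = C} {A = A} C-block r c a b) (bordered-cong 𝟎 A≗F a b)

    N′-local : ∀ a b → C′ (border r a) (border c b) ≡ N′ a b
    N′-local = bordered-block {C = C′} {A = A′} C′-block r c

    module _ {n} (σ : Fin n → Fin (suc s)) (τ : Fin n → Fin (suc t)) (τ-inj : Injective _≡_ _≡_ τ) where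

      private
        R = border r ∘ σ
        S = border c ∘ τ
        S-inj : Injective _≡_ _≡_ S
        S-inj = τ-inj ∘ border-injective c-inj

      invertible-minor-preserved : Invertible (submatrix N σ τ) → ¬ Singular (submatrix N′ σ τ)
      invertible-minor-preserved M-inv M′-sing = basis-preserved R S S-inj
        (Invertible-resp (λ a b → sym (N-local (σ a) (τ b))) M-inv)
        (Singular-resp (λ a b → sym (N′-local (σ a) (τ b))) M′-sing)

      singular-minor-preserved : (∃ λ l → σ l ≢ zero) →
                                 Singular (submatrix N σ τ) → ¬ Invertible (submatrix N′ σ τ)
      singular-minor-preserved (l , σl≢0) M-sing M′-inv =
        non-basis-preserved R S S-inj (l , border-≢fromℕ r σl≢0)
        (Singular-resp (λ a b → sym (N-local (σ a) (τ b))) M-sing)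
        (Invertible-resp (λ a b → sym (N′-local (σ a) (τ b))) M′-inv)

    zero-preserved : ∀ i j → F i j ≡ 𝟎 → G i j ≡ 𝟎
    zero-preserved i j Fij≡0 = decidable-stable (G i j ≟ 𝟎) λ Gij≢0 →
      singular-minor-preserved (suc i ∷ []) (suc j ∷ []) (singleton-injective _) (0F , λ ())
        (singular₁ _ Fij≡0) (invertible₁ _ Gij≢0)

    nonzero-preserved : ∀ i j → F i j ≢ 𝟎 → G i j ≢ 𝟎
    nonzero-preserved i j Fij≢0 Gij≡0 =
      invertible-minor-preserved (suc i ∷ []) (suc j ∷ []) (singleton-injective _)
        (invertible₁ _ Fij≢0) (singular₁ _ Gij≡0)

    -- [0 1; 1 F i j] is invertible, [w 1; 1 G i j] is not if G i j = w⁻¹.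
    avoids-inverse : ∀ i j → G i j ⊗ w ≢ 𝟏
    avoids-inverse i j Gw≡1 =
      invertible-minor-preserved (0F ∷ suc i ∷ []) (0F ∷ suc j ∷ []) (pair-injective λ ())
        (invertible₂ _ λ ()) (singular₂ _ (trans (⊗-comm w (G i j)) Gw≡1) (inj₂ λ ()))

    row-equality-preserved : ∀ i j j′ → F i j ≡ F i j′ → G i j ≡ G i j′
    row-equality-preserved i j j′ F≡ with j ≟F j′
    ... | yes refl = refl
    ... | no j≢j′ = decidable-stable (G i j ≟ G i j′) λ G≢ →
      singular-minor-preserved (0F ∷ suc i ∷ []) (suc j ∷ suc j′ ∷ []) (pair-injective (j≢j′ ∘ suc-injective))
        (1F , λ ()) (singular₂ _ (sym F≡) (inj₁ λ ())) (invertible₂ _ (G≢ ∘ sym))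

    column-equality-preserved : ∀ i i′ j → F i j ≡ F i′ j → G i j ≡ G i′ j
    column-equality-preserved i i′ j F≡ = decidable-stable (G i j ≟ G i′ j) λ G≢ →
      singular-minor-preserved (suc i ∷ suc i′ ∷ []) (0F ∷ suc j ∷ []) (pair-injective λ ())
        (0F , λ ()) (singular₂ _ (trans (sym F≡) (sym (*-identityʳ (F i j)))) (inj₁ λ ()))
        (invertible₂ _ λ G≡ → G≢ (sym (trans G≡ (*-identityʳ (G i j)))))

    nonsingular₂-preserved : ∀ i i′ j j′ → j ≢ j′ → F i j ≢ 𝟎 →
      F i j ⊗ F i′ j′ ≢ F i j′ ⊗ F i′ j → G i j ⊗ G i′ j′ ≢ G i j′ ⊗ G i′ j
    nonsingular₂-preserved i i′ j j′ j≢j′ Fij≢0 F-nonsingular G-singular =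
      invertible-minor-preserved (suc i ∷ suc i′ ∷ []) (suc j ∷ suc j′ ∷ [])
        (pair-injective (j≢j′ ∘ suc-injective)) (invertible₂ _ F-nonsingular)
        (singular₂ _ G-singular (inj₁ (nonzero-preserved i j Fij≢0)))

  module Shape (r : Fin 3 → Fin m) {c : Fin 3 → Fin k} (c-inj : Injective _≡_ _≡_ c)
    {x y z : GF4} (x≢0 : x ≢ 𝟎) (y≢0 : y ≢ 𝟎) (x≢y : x ≢ y)
    (A≗F : ∀ i j → A (r i) (c j) ≡ formII x y z i j) where

    open Bordered r c-inj A≗F public

    a b d : GF4
    a = G 0F 0F
    b = G 0F 1F
    d = G 2F 2F

    shape : ∀ i j → G i j ≡ formII a b d i j
    shape 0F 0F = refl
    shape 0F 1F = refl
    shape 0F 2F = sym (row-equality-preserved 0F 0F 2F refl)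
    shape 1F 0F = trans (row-equality-preserved 1F 0F 1F refl) (sym (column-equality-preserved 0F 1F 1F refl))
    shape 1F 1F = sym (column-equality-preserved 0F 1F 1F refl)
    shape 1F 2F = zero-preserved 1F 2F refl
    shape 2F 0F = sym (column-equality-preserved 0F 2F 0F refl)
    shape 2F 1F = zero-preserved 2F 1F refl
    shape 2F 2F = refl

    a≢0 : a ≢ 𝟎
    a≢0 = nonzero-preserved 0F 0F x≢0

    b≢0 : b ≢ 𝟎
    b≢0 = nonzero-preserved 0F 1F y≢0

    a≢b : a ≢ b
    a≢b a≡b = nonsingular₂-preserved 0F 1F 0F 1F (λ ()) x≢0
      (λ xy≡yy → x≢y (⊗-cancelˡ y x y y≢0 (trans (⊗-comm y x) xy≡yy)))
      (cong₂ _⊗_ a≡b (trans (shape 1F 1F) (sym (shape 1F 0F))))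

  module _ (w≢0 : w ≢ 𝟎) (w≢1 : w ≢ 𝟏)
    (r : Fin 3 → Fin m) {c : Fin 3 → Fin k} (c-inj : Injective _≡_ _≡_ c) where

    -- The whole bordered 4 × 4 submatrix is singular in C but invertible in C′.
    formI-excluded : ∀ {x y} → x ≢ 𝟎 → y ≢ 𝟎 → x ≢ y → ¬ (∀ i j → A (r i) (c j) ≡ formII x y 𝟎 i j)
    formI-excluded {x} {y} x≢0 y≢0 x≢y A≗F =
      singular-minor-preserved id id id (1F , λ ()) N-singular N′-invertible
      where
      open Shape r c-inj x≢0 y≢0 x≢y A≗F
      d≡0 : d ≡ 𝟎
      d≡0 = zero-preserved 2F 2F refl
      N-singular : Singular N
      N-singular = singular (x ⊗ y ∷ y ∷ x ⊕ y ∷ x ∷ []) (1F , y≢0) (formI-bordered-kernel x y x≢0 y≢0 x≢y)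
      N′-invertible : Invertible N′
      N′-invertible = Invertible-resp
        (bordered-cong w λ i j → sym (trans (shape i j) (cong (λ e → formII a b e i j) d≡0)))
        (formI-bordered-invertible w a b w≢0 w≢1 a≢0 b≢0 (avoids-inverse 0F 0F) (avoids-inverse 0F 1F) a≢b)

    -- The 3 × 3 submatrix itself is invertible in C but singular in C′.
    formII-excluded : ∀ {x y z} → x ≢ 𝟎 → y ≢ 𝟎 → z ≢ 𝟎 → x ≢ y → x ≢ z → y ≢ z →
                      ¬ (∀ i j → A (r i) (c j) ≡ formII x y z i j)
    formII-excluded {x} {y} {z} x≢0 y≢0 z≢0 x≢y x≢z y≢z A≗F =
      invertible-minor-preserved suc suc suc-injective
        (formII-invertible x y z x≢0 y≢0 z≢0 x≢y x≢z y≢z) G-singular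
      where
      open Shape r c-inj x≢0 y≢0 x≢y A≗F
      a≢d : a ≢ d
      a≢d a≡d = nonsingular₂-preserved 0F 2F 0F 2F (λ ()) x≢0
        (λ xz≡xx → x≢z (sym (⊗-cancelˡ x z x x≢0 xz≡xx)))
        (cong₂ _⊗_ (sym (shape 0F 2F)) (trans (sym a≡d) (sym (shape 2F 0F))))
      G-singular : Singular G
      G-singular = Singular-resp (λ i j → sym (shape i j)) (singular (b ∷ b ∷ a ∷ []) (0F , b≢0)
        (formII-kernel w a b d w≢0 w≢1 a≢0 b≢0 (nonzero-preserved 2F 2F z≢0)
          (avoids-inverse 0F 0F) (avoids-inverse 0F 1F) (avoids-inverse 2F 2F) a≢b a≢d))

lemma6p8 : (m k : ℕ) (A A' : Fin m → Fin k → GF4)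
    (C C' : Fin (suc m) → Fin (suc k) → GF4) (w : GF4) →
    IsBlock C A 𝟎 → IsBlock C' A' w → w ≢ 𝟎 → w ≢ 𝟏 →
    MatrixMatroid.IsCircuitHyperplane C (Xset m k) →
    (∀ B → MatrixMatroid.IsBasis C' B
         ⇔ (MatrixMatroid.IsBasis C B ⊎ B ≐ Xset m k)) →
    ((r : Fin 3 → Fin m) (c : Fin 3 → Fin k) →
       Injective _≡_ _≡_ r → Injective _≡_ _≡_ c →
       (x y : GF4) → x ≢ 𝟎 → y ≢ 𝟎 → x ≢ y →
       ¬ (∀ i j → A (r i) (c j) ≡ formI x y i j))
    ×
    ((r : Fin 3 → Fin m) (c : Fin 3 → Fin k) →
       Injective _≡_ _≡_ r → Injective _≡_ _≡_ c →
       (x y z : GF4) → x ≢ 𝟎 → y ≢ 𝟎 → z ≢ 𝟎 → x ≢ y → x ≢ z → y ≢ z →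
       ¬ (∀ i j → A (r i) (c j) ≡ formII x y z i j))
lemma6p8 m k A A′ C C′ w C-block C′-block w≢0 w≢1 _ bases =
  (λ r c _ c-inj x y x≢0 y≢0 x≢y A≗formI →
     formI-excluded w≢0 w≢1 r c-inj x≢0 y≢0 x≢y λ i j → trans (A≗formI i j) (formI≗formII x y i j))
  , (λ r c _ c-inj x y z → formII-excluded w≢0 w≢1 r c-inj)
  where open Relaxation A A′ C C′ C-block C′-block bases
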